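{- Let $G$ be a connected identifiable graph on $n\geq 3$ vertices. Then $\gamma^{\mathrm{ID}}(G)\leq n-s(G)+1$.
   Context: All graphs are finite, simple and undirected. A leaf is a vertex of degree $1$; a support vertex is a vertex adjacent to a leaf; $s(G)$ is the number of support vertices of $G$. $N[v]$ denotes the closed neighbourhood of $v$. A set $C\subseteq V(G)$ is an identifying code if for every vertex $v$ the set $N[v]\cap C$ is nonempty and for every two distinct vertices $u,v$ we have $N[u]\cap C\neq N[v]\cap C$. A graph is identifiable if it admits an identifying code, equivalently if no two distinct vertices have the same closed neighbourhood. $\gamma^{\mathrm{ID}}(G)$ is the minimum size of an identifying code of $G$. -}

module Defs where

open import Data.Nat using (ℕ; zero; suc; _+_; _∸_; _≤_)
open import Data.Fin using (Fin)
open import Data.Fin.Subset using (Subset; _∈_; ∣_∣)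
open import Data.Bool using (Bool; true; false)
open import Data.Bool.Properties renaming (_≟_ to _≟B_) using ()
open import Data.List using (List; []; _∷_; filter; length; allFin)
open import Data.Product using (∃; ∃-syntax; _×_; _,_)
open import Data.Sum using (_⊎_)
open import Relation.Nullary using (¬_; Dec)
open import Relation.Nullary.Decidable using (_×-dec_)
open import Relation.Binary.PropositionalEquality using (_≡_; _≢_)
open import Data.Nat.Properties renaming (_≟_ to _≟ℕ_) using ()
open import Data.Fin.Properties using (any?)

record Graph (n : ℕ) : Set where
  field
    adj    : Fin n → Fin n → Bool
    sym    : ∀ u v → adj u v ≡ adj v u
    irrefl : ∀ v → adj v v ≡ false

module _ {n : ℕ} (G : Graph n) where
  open Graph G

  Adj : Fin n → Fin n → Set
  Adj u v = adj u v ≡ true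

  degree : Fin n → ℕ
  degree v = length (filter (λ u → adj v u ≟B true) (allFin n))

  IsLeaf : Fin n → Set
  IsLeaf v = degree v ≡ 1

  IsSupport : Fin n → Set
  IsSupport v = ∃[ u ] (Adj v u × IsLeaf u)

  isSupport? : (v : Fin n) → Dec (IsSupport v)
  isSupport? v = any? (λ u → (adj v u ≟B true) ×-dec (degree u ≟ℕ 1))

  s : ℕ
  s = length (filter isSupport? (allFin n))

  data Walk : Fin n → Fin n → Set where
    here : ∀ {v} → Walk v v
    step : ∀ {u w v} → Adj u w → Walk w v → Walk u v

  Connected : Set
  Connected = ∀ u v → Walk u v

  -- w ∈ N[v]  (closed neighbourhood)
  InClosedNbhd : Fin n → Fin n → Set
  InClosedNbhd v w = (w ≡ v) ⊎ Adj v w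

  Identifiable : Set
  Identifiable = ∀ u v → u ≢ v →
    ¬ (∀ w → (InClosedNbhd u w → InClosedNbhd v w) × (InClosedNbhd v w → InClosedNbhd u w))

  IsIdentifyingCode : Subset n → Set
  IsIdentifyingCode C =
    (∀ v → ∃[ w ] (w ∈ C × InClosedNbhd v w)) ×
    (∀ u v → u ≢ v →
      ¬ (∀ w → w ∈ C → (InClosedNbhd u w → InClosedNbhd v w) × (InClosedNbhd v w → InClosedNbhd u w)))

  -- γ^ID(G) ≤ k  ⇔  some identifying code has size at most k
  IDCodeNumberAtMost : ℕ → Set
  IDCodeNumberAtMost k = ∃[ C ] (IsIdentifyingCode C × ∣ C ∣ ≤ k)

-- Choose a leaf ℓ(z) at every support vertex z, and call u and v twins when their closed
-- neighbourhoods agree outside the chosen leaves. Remove one vertex per support vertex: z itself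
-- if z is a redundant twin, ℓ(z) otherwise. The remaining n − s(G) vertices dominate G and
-- separate every pair except z, ℓ(z) for an exceptional z, one all of whose other neighbours were
-- removed. Those neighbours are twins of z, so z, its neighbours and their chosen leaves make up
-- the whole (connected) graph, which leaves no room for a second exceptional vertex; adding any
-- neighbour t ≠ ℓ(z) of z then gives an identifying code of size n − s(G) + 1.
module Submission where

open import Defs
open import Data.Nat using (ℕ; zero; suc; _+_; _∸_; _≤_; z≤n; s≤s)
import Data.Nat.Properties as ℕ
open import Data.Fin using (Fin; zero; suc; _<_)
open import Data.Fin.Properties
  using (any?; all?; suc-injective; 0≢1+n; _<?_; <-cmp) renaming (_≟_ to _≟F_)
open import Data.Fin.Subset using (Subset; _∈_; ∣_∣; ∁; _∪_; ⁅_⁆; _-_; inside; outside)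
open import Data.Fin.Subset.Properties
  using (x∈p⇒∣p-x∣<∣p∣; x∈p∧x≢y⇒x∈p-y; ∣∁p∣≡n∸∣p∣; x∈⁅x⁆; x∈p∪q⁺; x∉p⇒x∈∁p; ∣⁅x⁆∣≡1)
open import Data.Bool using (true; false)
open import Data.Bool.Properties using (_≟_)
open import Data.List using (filter; length; allFin)
import Data.List as List
open import Data.Vec using (tabulate; _∷_; []; here; there)
open import Data.Vec.Properties using (lookup∘tabulate; lookup⇒[]=; []=⇒lookup)
open import Data.Product using (∃; ∃-syntax; _×_; _,_; proj₁; proj₂)
open import Data.Sum using (_⊎_; inj₁; inj₂; [_,_]′)
open import Data.Empty using (⊥; ⊥-elim)
open import Function using (_∘_)
open import Relation.Binary.Definitions using (tri<; tri≈; tri>)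
open import Data.Fin.Induction using (<-wellFounded)
open import Induction.WellFounded using (Acc; acc)
open import Level using (Level)
open import Relation.Nullary using (¬_; Dec; yes; no; does)
open import Relation.Nullary.Decidable using (dec-true; _×-dec_; _⊎-dec_; _→-dec_; ¬?)
open import Relation.Unary using (Pred; Decidable)
open import Relation.Binary.PropositionalEquality using (_≡_; _≢_; refl; sym; trans; cong; subst)

private variable
  ℓ : Level
  n : ℕ

subsetOf : {P : Pred (Fin n) ℓ} → Decidable P → Subset n
subsetOf P? = tabulate (does ∘ P?)

module _ {P : Pred (Fin n) ℓ} (P? : Decidable P) where

  ∈-subsetOf⁺ : ∀ {x} → P x → x ∈ subsetOf P?
  ∈-subsetOf⁺ {x} px = lookup⇒[]= x _ (trans (lookup∘tabulate _ x) (dec-true (P? x) px))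

  ∈-subsetOf⁻ : ∀ {x} → x ∈ subsetOf P? → P x
  ∈-subsetOf⁻ {x} x∈ with P? x | trans (sym (lookup∘tabulate _ x)) ([]=⇒lookup x∈)
  ... | yes px | _ = px
  ... | no _   | ()

length-filter-tabulate : ∀ {A : Set} {P : Pred A ℓ} (P? : Decidable P) (f : Fin n → A) →
  length (filter P? (List.tabulate f)) ≡ ∣ subsetOf (P? ∘ f) ∣
length-filter-tabulate {n = zero}  P? f = refl
length-filter-tabulate {n = suc n} P? f with does (P? (f zero))
... | true  = cong suc (length-filter-tabulate P? (f ∘ suc))
... | false = length-filter-tabulate P? (f ∘ suc)

length-filter-allFin : {P : Pred (Fin n) ℓ} (P? : Decidable P) →
  length (filter P? (allFin n)) ≡ ∣ subsetOf P? ∣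
length-filter-allFin P? = length-filter-tabulate P? (λ x → x)

∣p∪q∣≤∣p∣+∣q∣ : (p q : Subset n) → ∣ p ∪ q ∣ ≤ ∣ p ∣ + ∣ q ∣
∣p∪q∣≤∣p∣+∣q∣ []            []            = z≤n
∣p∪q∣≤∣p∣+∣q∣ (outside ∷ p) (outside ∷ q) = ∣p∪q∣≤∣p∣+∣q∣ p q
∣p∪q∣≤∣p∣+∣q∣ (inside  ∷ p) (outside ∷ q) = s≤s (∣p∪q∣≤∣p∣+∣q∣ p q)
∣p∪q∣≤∣p∣+∣q∣ (outside ∷ p) (inside  ∷ q) =
  ℕ.≤-trans (s≤s (∣p∪q∣≤∣p∣+∣q∣ p q)) (ℕ.≤-reflexive (sym (ℕ.+-suc ∣ p ∣ ∣ q ∣)))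
∣p∪q∣≤∣p∣+∣q∣ (inside  ∷ p) (inside  ∷ q) =
  s≤s (ℕ.≤-trans (∣p∪q∣≤∣p∣+∣q∣ p q) (ℕ.+-monoʳ-≤ ∣ p ∣ (ℕ.n≤1+n ∣ q ∣)))

injectiveOn⇒∣p∣≤∣q∣ : ∀ {m} (p : Subset n) {q : Subset m} (f : Fin n → Fin m) →
  (∀ {x} → x ∈ p → f x ∈ q) →
  (∀ {x y} → x ∈ p → y ∈ p → f x ≡ f y → x ≡ y) →
  ∣ p ∣ ≤ ∣ q ∣
injectiveOn⇒∣p∣≤∣q∣ []            f maps inj = z≤n
injectiveOn⇒∣p∣≤∣q∣ (outside ∷ p) f maps inj =
  injectiveOn⇒∣p∣≤∣q∣ p (f ∘ suc) (maps ∘ there) λ x∈p y∈p → suc-injective ∘ inj (there x∈p) (there y∈p)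
injectiveOn⇒∣p∣≤∣q∣ (inside ∷ p) f maps inj =
  ℕ.≤-trans (s≤s (injectiveOn⇒∣p∣≤∣q∣ p (f ∘ suc) maps′ λ x∈p y∈p → suc-injective ∘ inj (there x∈p) (there y∈p)))
            (x∈p⇒∣p-x∣<∣p∣ (maps here))
  where
  maps′ : ∀ {x} → x ∈ p → f (suc x) ∈ _ - f zero
  maps′ x∈p = x∈p∧x≢y⇒x∈p-y (maps (there x∈p)) λ e → 0≢1+n (inj here (there x∈p) (sym e))

two-elements⇒2≤∣p∣ : {p : Subset n} {x y : Fin n} → x ∈ p → y ∈ p → x ≢ y → 2 ≤ ∣ p ∣
two-elements⇒2≤∣p∣ x∈p y∈p x≢y =
  ℕ.≤-trans (s≤s (ℕ.≤-trans (s≤s z≤n) (x∈p⇒∣p-x∣<∣p∣ (x∈p∧x≢y⇒x∈p-y y∈p (x≢y ∘ sym)))))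
            (x∈p⇒∣p-x∣<∣p∣ x∈p)

module GraphProperties {n : ℕ} (G : Graph n) where
  open Graph G using (adj; irrefl)

  Adj? : ∀ u v → Dec (Adj G u v)
  Adj? u v = adj u v ≟ true

  Adj-sym : ∀ {u v} → Adj G u v → Adj G v u
  Adj-sym {u} {v} uv = trans (Graph.sym G v u) uv

  Adj-irrefl : ∀ {v} → ¬ Adj G v v
  Adj-irrefl {v} vv with trans (sym vv) (irrefl v)
  ... | ()

  infix 4 _∈N[_]
  _∈N[_] : Fin n → Fin n → Set
  w ∈N[ v ] = InClosedNbhd G v w

  _∈N[_]? : ∀ w v → Dec (w ∈N[ v ])
  w ∈N[ v ]? = (w ≟F v) ⊎-dec Adj? v w

  ∈N[]-sym : ∀ {u v} → u ∈N[ v ] → v ∈N[ u ]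
  ∈N[]-sym (inj₁ refl) = inj₁ refl
  ∈N[]-sym (inj₂ vu)   = inj₂ (Adj-sym vu)

  walk-closed : (P : Pred (Fin n) ℓ) → (∀ {x y} → P x → Adj G x y → P y) →
    ∀ {u v} → Walk G u v → P u → P v
  walk-closed P closed here         pu = pu
  walk-closed P closed (step uw wv) pu = walk-closed P closed wv (closed pu uw)

  leaf-neighbour-unique : ∀ {v u u′} → IsLeaf G v → Adj G v u → Adj G v u′ → u ≡ u′
  leaf-neighbour-unique {v} {u} {u′} deg≡1 vu vu′ with u ≟F u′
  ... | yes u≡u′ = u≡u′
  ... | no u≢u′
    with ℕ.≤-trans (two-elements⇒2≤∣p∣ (∈-subsetOf⁺ (Adj? v) vu) (∈-subsetOf⁺ (Adj? v) vu′) u≢u′)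
                   (ℕ.≤-reflexive (trans (sym (length-filter-allFin (Adj? v))) deg≡1))
  ... | s≤s ()

third-element : 3 ≤ n → (a b : Fin n) → ∃[ w ] (w ≢ a × w ≢ b)
third-element (s≤s (s≤s (s≤s _))) a b with zero ≟F a | zero ≟F b
... | no 0≢a | no 0≢b = zero , 0≢a , 0≢b
third-element (s≤s (s≤s (s≤s _))) a b | yes refl | _ with suc zero ≟F b
... | no 1≢b  = suc zero , (λ ()) , 1≢b
... | yes refl = suc (suc zero) , (λ ()) , (λ ())
third-element (s≤s (s≤s (s≤s _))) a b | no 0≢a | yes refl with suc zero ≟F a
... | no 1≢a  = suc zero , 1≢a , (λ ())
... | yes refl = suc (suc zero) , (λ ()) , (λ ())

module Construction {n : ℕ} (G : Graph n) (3≤n : 3 ≤ n) (connected : Connected G) where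
  open GraphProperties G

  leaf : Fin n → Fin n
  leaf z with isSupport? G z
  ... | yes (u , _) = u
  ... | no _        = z

  leaf-adj : ∀ {z} → IsSupport G z → Adj G z (leaf z)
  leaf-adj {z} sz with isSupport? G z
  ... | yes (_ , zu , _) = zu
  ... | no ¬sz           = ⊥-elim (¬sz sz)

  leaf-isLeaf : ∀ {z} → IsSupport G z → IsLeaf G (leaf z)
  leaf-isLeaf {z} sz with isSupport? G z
  ... | yes (_ , _ , u-leaf) = u-leaf
  ... | no ¬sz               = ⊥-elim (¬sz sz)

  leaf-neighbour : ∀ {z u} → IsSupport G z → Adj G (leaf z) u → u ≡ z
  leaf-neighbour sz ℓu = leaf-neighbour-unique (leaf-isLeaf sz) ℓu (Adj-sym (leaf-adj sz))

  leaf-injective : ∀ {z z′} → IsSupport G z → IsSupport G z′ → leaf z ≡ leaf z′ → z ≡ z′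
  leaf-injective sz sz′ ℓ≡ℓ′ = leaf-neighbour sz′ (subst (λ x → Adj G x _) ℓ≡ℓ′ (Adj-sym (leaf-adj sz)))

  -- Otherwise the vertex set would be the single edge {z, leaf z}, while n ≥ 3.
  support-other-neighbour : ∀ {z} → IsSupport G z → ∃[ t ] (Adj G z t × t ≢ leaf z)
  support-other-neighbour {z} sz with any? (λ t → Adj? z t ×-dec ¬? (t ≟F leaf z))
  ... | yes found = found
  ... | no none with third-element 3≤n z (leaf z)
  ... | w , w≢z , w≢ℓ = ⊥-elim ([ w≢z , w≢ℓ ]′ (walk-closed Edge closed (connected z w) (inj₁ refl)))
    where
    Edge : Pred (Fin n) _
    Edge x = x ≡ z ⊎ x ≡ leaf z
    closed : ∀ {x y} → Edge x → Adj G x y → Edge y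
    closed {y = y} (inj₁ refl) zy with y ≟F leaf z
    ... | yes y≡ℓ = inj₂ y≡ℓ
    ... | no y≢ℓ  = ⊥-elim (none (_ , zy , y≢ℓ))
    closed (inj₂ refl) ℓy = inj₁ (leaf-neighbour sz ℓy)

  support-not-leaf : ∀ {z} → IsSupport G z → ¬ IsLeaf G z
  support-not-leaf sz z-leaf with support-other-neighbour sz
  ... | t , zt , t≢ℓ = t≢ℓ (leaf-neighbour-unique z-leaf zt (leaf-adj sz))

  ChosenLeaf : Pred (Fin n) _
  ChosenLeaf v = ∃[ z ] (IsSupport G z × leaf z ≡ v)

  ChosenLeaf? : Decidable ChosenLeaf
  ChosenLeaf? v = any? (λ z → isSupport? G z ×-dec (leaf z ≟F v))

  support-not-chosen : ∀ {z} → IsSupport G z → ¬ ChosenLeaf z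
  support-not-chosen sz (z′ , sz′ , refl) = support-not-leaf sz (leaf-isLeaf sz′)

  Twins : Fin n → Fin n → Set
  Twins u v = ∀ w → ¬ ChosenLeaf w → (w ∈N[ u ] → w ∈N[ v ]) × (w ∈N[ v ] → w ∈N[ u ])

  Twins? : ∀ u v → Dec (Twins u v)
  Twins? u v = all? λ w →
    ¬? (ChosenLeaf? w) →-dec ((w ∈N[ u ]? →-dec w ∈N[ v ]?) ×-dec (w ∈N[ v ]? →-dec w ∈N[ u ]?))

  Twins-sym : ∀ {u v} → Twins u v → Twins v u
  Twins-sym uv w ¬ℓw = proj₂ (uv w ¬ℓw) , proj₁ (uv w ¬ℓw)

  Twins-trans : ∀ {u v x} → Twins u v → Twins v x → Twins u x
  Twins-trans uv vx w ¬ℓw = proj₁ (vx w ¬ℓw) ∘ proj₁ (uv w ¬ℓw) , proj₂ (uv w ¬ℓw) ∘ proj₂ (vx w ¬ℓw)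

  twins-adjacent : ∀ {u v} → Twins u v → u ≢ v → ¬ ChosenLeaf u → Adj G u v
  twins-adjacent {u} uv u≢v ¬ℓu with proj₁ (uv u ¬ℓu) (inj₁ refl)
  ... | inj₁ u≡v = ⊥-elim (u≢v u≡v)
  ... | inj₂ vu  = Adj-sym vu

  -- In every twin class, the non-support vertex (there is at most one) or else the least
  -- support vertex is kept as representative; the other support vertices are redundant.
  RedundantTwin : Pred (Fin n) _
  RedundantTwin u = IsSupport G u ×
    ∃[ v ] (v ≢ u × ¬ ChosenLeaf v × Twins u v × (¬ IsSupport G v ⊎ v < u))

  RedundantTwin? : Decidable RedundantTwin
  RedundantTwin? u = isSupport? G u ×-dec any? λ v →
    ¬? (v ≟F u) ×-dec ¬? (ChosenLeaf? v) ×-dec Twins? u v ×-dec (¬? (isSupport? G v) ⊎-dec (v <? u))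

  representative : ∀ {u} → RedundantTwin u →
    ∃[ r ] (r ≢ u × ¬ ChosenLeaf r × Twins u r × ¬ RedundantTwin r)
  representative {u} = go u (<-wellFounded u)
    where
    go : ∀ u → Acc _<_ u → RedundantTwin u →
      ∃[ r ] (r ≢ u × ¬ ChosenLeaf r × Twins u r × ¬ RedundantTwin r)
    go u (acc smaller) u-red@(_ , v , v≢u , ¬ℓv , uv , v-smaller) with RedundantTwin? v
    ... | no ¬v-red = v , v≢u , ¬ℓv , uv , ¬v-red
    ... | yes v-red@(sv , _) with v-smaller
    ...   | inj₁ ¬sv = ⊥-elim (¬sv sv)
    ...   | inj₂ v<u with go v (smaller v<u) v-red
    ...     | r , r≢v , ¬ℓr , vr , ¬r-red =
      r , (λ { refl → ¬r-red u-red }) , ¬ℓr , Twins-trans uv vr , ¬r-red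

  Removed : Pred (Fin n) _
  Removed v = (∃[ z ] (IsSupport G z × leaf z ≡ v × ¬ RedundantTwin z)) ⊎ RedundantTwin v

  Removed? : Decidable Removed
  Removed? v =
    any? (λ z → isSupport? G z ×-dec (leaf z ≟F v) ×-dec ¬? (RedundantTwin? z)) ⊎-dec RedundantTwin? v

  representative-kept : ∀ {r} → ¬ ChosenLeaf r → ¬ RedundantTwin r → ¬ Removed r
  representative-kept ¬ℓr ¬r-red (inj₁ (z , sz , ℓz≡r , _)) = ¬ℓr (z , sz , ℓz≡r)
  representative-kept ¬ℓr ¬r-red (inj₂ r-red)              = ¬r-red r-red

  support-kept : ∀ {z} → IsSupport G z → ¬ RedundantTwin z → ¬ Removed z
  support-kept sz = representative-kept (support-not-chosen sz)

  redundant-leaf-kept : ∀ {u} → RedundantTwin u → ¬ Removed (leaf u)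
  redundant-leaf-kept u-red@(su , _) (inj₁ (z , sz , ℓz≡ℓu , ¬z-red))
    with refl ← leaf-injective sz su ℓz≡ℓu = ¬z-red u-red
  redundant-leaf-kept (su , _) (inj₂ (sℓu , _)) = support-not-chosen sℓu (_ , su , refl)

  kept-dominating : ∀ v → ∃[ w ] (¬ Removed w × w ∈N[ v ])
  kept-dominating v with Removed? v
  ... | no ¬rv = v , ¬rv , inj₁ refl
  ... | yes (inj₁ (z , sz , refl , ¬z-red)) =
    z , support-kept sz ¬z-red , inj₂ (Adj-sym (leaf-adj sz))
  ... | yes (inj₂ v-red@(sv , _)) = leaf v , redundant-leaf-kept v-red , inj₂ (leaf-adj sv)

  AgreeOnKept : Fin n → Fin n → Set
  AgreeOnKept p q = ∀ w → ¬ Removed w → (w ∈N[ p ] → w ∈N[ q ]) × (w ∈N[ q ] → w ∈N[ p ])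

  AgreeOnKept-sym : ∀ {p q} → AgreeOnKept p q → AgreeOnKept q p
  AgreeOnKept-sym pq w ¬rw = proj₂ (pq w ¬rw) , proj₁ (pq w ¬rw)

  Exceptional : Pred (Fin n) _
  Exceptional z = IsSupport G z × ¬ RedundantTwin z × (∀ t → Adj G z t → t ≢ leaf z → Removed t)

  Exceptional? : Decidable Exceptional
  Exceptional? z = isSupport? G z ×-dec ¬? (RedundantTwin? z) ×-dec
    all? (λ t → Adj? z t →-dec (¬? (t ≟F leaf z) →-dec Removed? t))

  exceptional-kept : ∀ {z} → Exceptional z → ¬ Removed z
  exceptional-kept (sz , ¬z-red , _) = support-kept sz ¬z-red

  agree⇒¬redundant : ∀ {p q} → p ≢ q → AgreeOnKept p q → ¬ RedundantTwin p
  agree⇒¬redundant {p} {q} p≢q pq p-red@(sp , _)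
    with representative p-red | proj₁ (pq (leaf p) (redundant-leaf-kept p-red)) (inj₂ (leaf-adj sp))
  ... | _ | inj₂ qℓp = p≢q (sym (leaf-neighbour sp (Adj-sym qℓp)))
  ... | r , r≢p , ¬ℓr , pr , ¬r-red | inj₁ refl
    with proj₁ (pq r (representative-kept ¬ℓr ¬r-red))
               (inj₂ (twins-adjacent pr (r≢p ∘ sym) (support-not-chosen sp)))
  ...   | inj₁ r≡ℓp = ¬ℓr (p , sp , sym r≡ℓp)
  ...   | inj₂ ℓpr  = r≢p (leaf-neighbour sp ℓpr)

  agree-removed-kept⇒exceptional : ∀ {p q} → p ≢ q → AgreeOnKept p q → Removed p → ¬ Removed q →
    Exceptional q × p ≡ leaf q
  agree-removed-kept⇒exceptional p≢q pq (inj₂ p-red) ¬rq = ⊥-elim (agree⇒¬redundant p≢q pq p-red)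
  agree-removed-kept⇒exceptional {q = q} p≢q pq (inj₁ (z , sz , refl , ¬z-red)) ¬rq
    with proj₂ (pq q ¬rq) (inj₁ refl)
  ... | inj₁ q≡ℓz = ⊥-elim (p≢q (sym q≡ℓz))
  ... | inj₂ ℓzq with refl ← leaf-neighbour sz ℓzq = (sz , ¬z-red , neighbours-removed) , refl
    where
    neighbours-removed : ∀ t → Adj G q t → t ≢ leaf q → Removed t
    neighbours-removed t qt t≢ℓq with Removed? t
    ... | yes rt = rt
    ... | no ¬rt with proj₂ (pq t ¬rt) (inj₂ qt)
    ...   | inj₁ t≡ℓq = ⊥-elim (t≢ℓq t≡ℓq)
    ...   | inj₂ ℓqt with refl ← leaf-neighbour sz ℓqt = ⊥-elim (Adj-irrefl qt)

  agree⇒¬both-removed : ∀ {p q} → p ≢ q → AgreeOnKept p q → Removed p → ¬ Removed q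
  agree⇒¬both-removed p≢q pq (inj₂ p-red) _ = agree⇒¬redundant p≢q pq p-red
  agree⇒¬both-removed p≢q pq _ (inj₂ q-red) = agree⇒¬redundant (p≢q ∘ sym) (AgreeOnKept-sym pq) q-red
  agree⇒¬both-removed p≢q pq (inj₁ (z , sz , refl , ¬z-red)) (inj₁ (z′ , sz′ , refl , _))
    with proj₁ (pq z (support-kept sz ¬z-red)) (inj₂ (Adj-sym (leaf-adj sz)))
  ... | inj₁ z≡ℓz′ = support-not-chosen sz (z′ , sz′ , sym z≡ℓz′)
  ... | inj₂ ℓz′z with refl ← leaf-neighbour sz′ ℓz′z = p≢q refl

  agree⇒kept-not-chosen : ∀ {p q} → p ≢ q → AgreeOnKept p q → ¬ Removed p → ¬ Removed q → ¬ ChosenLeaf p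
  agree⇒kept-not-chosen {q = q} p≢q pq ¬rp ¬rq (z , sz , refl) with proj₁ (pq (leaf z) ¬rp) (inj₁ refl)
  ... | inj₁ ℓz≡q = p≢q ℓz≡q
  ... | inj₂ qℓz with leaf-neighbour sz (Adj-sym qℓz)
  ...   | refl with RedundantTwin? q
  ...     | yes q-red = ¬rq (inj₂ q-red)
  ...     | no ¬q-red = ¬rp (inj₁ (q , sz , refl , ¬q-red))

  -- A removed, non-chosen w is a redundant twin; its kept representative relays adjacency.
  kept-agree⇒N[]⊆ : ∀ {p q} → AgreeOnKept p q → ¬ ChosenLeaf p → ¬ ChosenLeaf q →
    ∀ w → ¬ ChosenLeaf w → w ∈N[ p ] → w ∈N[ q ]
  kept-agree⇒N[]⊆ {p} {q} pq ¬ℓp ¬ℓq w ¬ℓw w∈Np with Removed? w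
  ... | no ¬rw = proj₁ (pq w ¬rw) w∈Np
  ... | yes (inj₁ (z , sz , ℓz≡w , _)) = ⊥-elim (¬ℓw (z , sz , ℓz≡w))
  ... | yes (inj₂ w-red) with representative w-red
  ...   | r , _ , ¬ℓr , wr , ¬r-red = ∈N[]-sym (proj₂ (wr q ¬ℓq) q∈Nr)
    where
    p∈Nr : p ∈N[ r ]
    p∈Nr = proj₁ (wr p ¬ℓp) (∈N[]-sym w∈Np)
    q∈Nr : q ∈N[ r ]
    q∈Nr = ∈N[]-sym (proj₁ (pq r (representative-kept ¬ℓr ¬r-red)) (∈N[]-sym p∈Nr))

  chosen-outside-N[] : ∀ {x w} → ¬ IsSupport G x → ¬ ChosenLeaf x → ChosenLeaf w → ¬ w ∈N[ x ]
  chosen-outside-N[] ¬sx ¬ℓx ℓx (inj₁ refl) = ¬ℓx ℓx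
  chosen-outside-N[] ¬sx ¬ℓx (z , sz , refl) (inj₂ xℓz)
    with refl ← leaf-neighbour sz (Adj-sym xℓz) = ¬sx sz

  agree⇒¬both-kept : Identifiable G → ∀ {p q} → p ≢ q → AgreeOnKept p q → ¬ Removed p → ¬ Removed q → ⊥
  agree⇒¬both-kept identifiable {p} {q} p≢q pq ¬rp ¬rq = by-support (isSupport? G p) (isSupport? G q)
    where
    ¬ℓp : ¬ ChosenLeaf p
    ¬ℓp = agree⇒kept-not-chosen p≢q pq ¬rp ¬rq
    ¬ℓq : ¬ ChosenLeaf q
    ¬ℓq = agree⇒kept-not-chosen (p≢q ∘ sym) (AgreeOnKept-sym pq) ¬rq ¬rp
    pq-twins : Twins p q
    pq-twins w ¬ℓw =
      kept-agree⇒N[]⊆ pq ¬ℓp ¬ℓq w ¬ℓw , kept-agree⇒N[]⊆ (AgreeOnKept-sym pq) ¬ℓq ¬ℓp w ¬ℓw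
    p-not-redundant : IsSupport G p → ¬ (¬ IsSupport G q ⊎ q < p)
    p-not-redundant sp q-smaller = ¬rp (inj₂ (sp , q , p≢q ∘ sym , ¬ℓq , pq-twins , q-smaller))
    q-not-redundant : IsSupport G q → ¬ (¬ IsSupport G p ⊎ p < q)
    q-not-redundant sq p-smaller = ¬rq (inj₂ (sq , p , p≢q , ¬ℓp , Twins-sym pq-twins , p-smaller))
    by-support : Dec (IsSupport G p) → Dec (IsSupport G q) → ⊥
    by-support (yes sp) (yes sq) with <-cmp p q
    ... | tri< p<q _ _ = q-not-redundant sq (inj₂ p<q)
    ... | tri≈ _ p≡q _ = p≢q p≡q
    ... | tri> _ _ q<p = p-not-redundant sp (inj₂ q<p)
    by-support (yes sp) (no ¬sq) = p-not-redundant sp (inj₁ ¬sq)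
    by-support (no ¬sp) (yes sq) = q-not-redundant sq (inj₁ ¬sp)
    by-support (no ¬sp) (no ¬sq) = identifiable p q p≢q same-N[]
      where
      same-N[] : ∀ w → (w ∈N[ p ] → w ∈N[ q ]) × (w ∈N[ q ] → w ∈N[ p ])
      same-N[] w with ChosenLeaf? w
      ... | no ¬ℓw = pq-twins w ¬ℓw
      ... | yes ℓw = ⊥-elim ∘ chosen-outside-N[] ¬sp ¬ℓp ℓw , ⊥-elim ∘ chosen-outside-N[] ¬sq ¬ℓq ℓw

  agree⇒exceptional-pair : Identifiable G → ∀ {p q} → p ≢ q → AgreeOnKept p q →
    ∃[ z ] (Exceptional z × ((p ≡ leaf z × q ≡ z) ⊎ (p ≡ z × q ≡ leaf z)))
  agree⇒exceptional-pair identifiable {p} {q} p≢q pq with Removed? p | Removed? q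
  ... | yes rp | yes rq = ⊥-elim (agree⇒¬both-removed p≢q pq rp rq)
  ... | no ¬rp | no ¬rq = ⊥-elim (agree⇒¬both-kept identifiable p≢q pq ¬rp ¬rq)
  ... | yes rp | no ¬rq with agree-removed-kept⇒exceptional p≢q pq rp ¬rq
  ...   | eq , p≡ℓq = q , eq , inj₁ (p≡ℓq , refl)
  agree⇒exceptional-pair identifiable {p} {q} p≢q pq | no ¬rp | yes rq
    with agree-removed-kept⇒exceptional (p≢q ∘ sym) (AgreeOnKept-sym pq) rq ¬rp
  ...   | ep , q≡ℓp = p , ep , inj₂ (refl , q≡ℓp)

  exceptional-neighbour : ∀ {z v} → Exceptional z → Adj G z v → v ≢ leaf z → RedundantTwin v × Twins v z
  exceptional-neighbour ez@(sz , _ , neighbours-removed) zv v≢ℓz with neighbours-removed _ zv v≢ℓz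
  ... | inj₁ (z′ , sz′ , refl , _) with refl ← leaf-neighbour sz′ (Adj-sym zv) = ⊥-elim (v≢ℓz refl)
  ... | inj₂ v-red with representative v-red
  ...   | r , _ , ¬ℓr , vr , ¬r-red with proj₁ (vr _ (support-not-chosen sz)) (inj₂ (Adj-sym zv))
  ...     | inj₁ refl = v-red , vr
  ...     | inj₂ rz   = ⊥-elim (representative-kept ¬ℓr ¬r-red
                          (neighbours-removed r (Adj-sym rz) λ r≡ℓz → ¬ℓr (_ , sz , sym r≡ℓz)))

  Around : Fin n → Pred (Fin n) _
  Around z v = v ≡ z ⊎ Adj G z v ⊎ ∃[ u ] (Adj G z u × u ≢ leaf z × v ≡ leaf u)

  around-closed : ∀ {z} → Exceptional z → ∀ {v w} → Around z v → Adj G v w → Around z w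
  around-closed ez (inj₁ refl) zw = inj₂ (inj₁ zw)
  around-closed {z} ez@(sz , _) {v} {w} (inj₂ (inj₁ zv)) vw with v ≟F leaf z
  ... | yes refl = inj₁ (leaf-neighbour sz vw)
  ... | no v≢ℓz with exceptional-neighbour ez zv v≢ℓz | ChosenLeaf? w
  ...   | _ , vz | no ¬ℓw = [ inj₁ , inj₂ ∘ inj₁ ]′ (proj₁ (vz w ¬ℓw) (inj₂ vw))
  ...   | _ | yes (u , su , refl) with refl ← leaf-neighbour su (Adj-sym vw) =
    inj₂ (inj₂ (v , zv , v≢ℓz , refl))
  around-closed ez (inj₂ (inj₂ (u , zu , u≢ℓz , refl))) ℓuw with exceptional-neighbour ez zu u≢ℓz
  ... | (su , _) , _ with refl ← leaf-neighbour su ℓuw = inj₂ (inj₁ zu)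

  exceptional-unique : ∀ {z z′} → Exceptional z → Exceptional z′ → z ≡ z′
  exceptional-unique {z} {z′} ez@(sz , _ , neighbours-removed) ez′@(sz′ , _)
    with walk-closed (Around z) (around-closed ez) (connected z z′) (inj₁ refl)
  ... | inj₁ z′≡z = sym z′≡z
  ... | inj₂ (inj₁ zz′) =
    ⊥-elim (exceptional-kept ez′
      (neighbours-removed z′ zz′ λ z′≡ℓz → support-not-chosen sz′ (z , sz , sym z′≡ℓz)))
  ... | inj₂ (inj₂ (u , zu , u≢ℓz , z′≡ℓu)) =
    ⊥-elim (support-not-chosen sz′ (u , proj₁ (proj₁ (exceptional-neighbour ez zu u≢ℓz)) , sym z′≡ℓu))

  support-private-neighbour : ∀ {z} → IsSupport G z → ∃[ t ] (t ∈N[ z ] × ¬ t ∈N[ leaf z ])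
  support-private-neighbour sz with support-other-neighbour sz
  ... | t , zt , t≢ℓz = t , inj₂ zt , λ where
    (inj₁ t≡ℓz) → t≢ℓz t≡ℓz
    (inj₂ ℓzt)  → Adj-irrefl (subst (Adj G _) (leaf-neighbour sz ℓzt) zt)

  removedFor : Fin n → Fin n
  removedFor z with RedundantTwin? z
  ... | yes _ = z
  ... | no _  = leaf z

  removedFor-removed : ∀ {z} → IsSupport G z → Removed (removedFor z)
  removedFor-removed {z} sz with RedundantTwin? z
  ... | yes z-red = inj₂ z-red
  ... | no ¬z-red = inj₁ (z , sz , refl , ¬z-red)

  removedFor-injective : ∀ {z z′} → IsSupport G z → IsSupport G z′ →
    removedFor z ≡ removedFor z′ → z ≡ z′
  removedFor-injective {z} {z′} sz sz′ e with RedundantTwin? z | RedundantTwin? z′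
  ... | yes _ | yes _ = e
  ... | yes _ | no _  = ⊥-elim (support-not-chosen sz (z′ , sz′ , sym e))
  ... | no _  | yes _ = ⊥-elim (support-not-chosen sz′ (z , sz , e))
  ... | no _  | no _  = leaf-injective sz sz′ e

  Kept : Subset n
  Kept = ∁ (subsetOf Removed?)

  ∈Kept : ∀ {w} → ¬ Removed w → w ∈ Kept
  ∈Kept ¬rw = x∉p⇒x∈∁p (¬rw ∘ ∈-subsetOf⁻ Removed?)

  ∣Kept∣≤n∸s : ∣ Kept ∣ ≤ n ∸ s G
  ∣Kept∣≤n∸s = begin
    ∣ Kept ∣                 ≡⟨ ∣∁p∣≡n∸∣p∣ (subsetOf Removed?) ⟩
    n ∸ ∣ subsetOf Removed? ∣ ≤⟨ ℕ.∸-monoʳ-≤ n s≤∣Removed∣ ⟩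
    n ∸ s G                  ∎
    where
    open ℕ.≤-Reasoning
    isSupport⁻ : ∀ {z} → z ∈ subsetOf (isSupport? G) → IsSupport G z
    isSupport⁻ = ∈-subsetOf⁻ (isSupport? G)
    s≤∣Removed∣ : s G ≤ ∣ subsetOf Removed? ∣
    s≤∣Removed∣ = subst (_≤ ∣ subsetOf Removed? ∣) (sym (length-filter-allFin (isSupport? G)))
      (injectiveOn⇒∣p∣≤∣q∣ (subsetOf (isSupport? G)) removedFor
        (∈-subsetOf⁺ Removed? ∘ removedFor-removed ∘ isSupport⁻)
        (λ z∈S z′∈S → removedFor-injective (isSupport⁻ z∈S) (isSupport⁻ z′∈S)))

  identifying-code : Identifiable G → (C : Subset n) → (∀ {w} → ¬ Removed w → w ∈ C) →
    (∀ {z} → Exceptional z → ∃[ w ] (w ∈ C × w ∈N[ z ] × ¬ w ∈N[ leaf z ])) →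
    IsIdentifyingCode G C
  identifying-code identifiable C kept⊆C separates = dominating , separating
    where
    dominating : ∀ v → ∃[ w ] (w ∈ C × w ∈N[ v ])
    dominating v with kept-dominating v
    ... | w , ¬rw , w∈Nv = w , kept⊆C ¬rw , w∈Nv
    separating : ∀ u v → u ≢ v → ¬ (∀ w → w ∈ C → (w ∈N[ u ] → w ∈N[ v ]) × (w ∈N[ v ] → w ∈N[ u ]))
    separating u v u≢v agree
      with agree⇒exceptional-pair identifiable u≢v (λ w ¬rw → agree w (kept⊆C ¬rw))
    ... | z , ez , pair with separates ez | pair
    ...   | w , w∈C , w∈Nz , w∉Nℓz | inj₁ (refl , refl) = w∉Nℓz (proj₂ (agree w w∈C) w∈Nz)
    ...   | w , w∈C , w∈Nz , w∉Nℓz | inj₂ (refl , refl) = w∉Nℓz (proj₁ (agree w w∈C) w∈Nz)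

theorem5 : (n : ℕ) → 3 ≤ n → (G : Graph n) → Connected G → Identifiable G →
    IDCodeNumberAtMost G (n ∸ s G + 1)
theorem5 n 3≤n G connected identifiable = by-exceptional (any? Exceptional?)
  where
  open GraphProperties G using (_∈N[_])
  open Construction G 3≤n connected
  by-exceptional : Dec (∃ Exceptional) → IDCodeNumberAtMost G (n ∸ s G + 1)
  by-exceptional (no none) =
    Kept , identifying-code identifiable Kept ∈Kept (λ ez → ⊥-elim (none (_ , ez))) ,
    ℕ.≤-trans ∣Kept∣≤n∸s (ℕ.m≤m+n _ 1)
  by-exceptional (yes (z₀ , ez₀)) with support-private-neighbour (proj₁ ez₀)
  ... | t , t∈Nz₀ , t∉Nℓz₀ =
    Kept ∪ ⁅ t ⁆ , identifying-code identifiable _ (x∈p∪q⁺ ∘ inj₁ ∘ ∈Kept) separated-by-t , size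
    where
    separated-by-t : ∀ {z} → Exceptional z → ∃[ w ] (w ∈ Kept ∪ ⁅ t ⁆ × w ∈N[ z ] × ¬ w ∈N[ leaf z ])
    separated-by-t ez with refl ← exceptional-unique ez₀ ez =
      t , x∈p∪q⁺ (inj₂ (x∈⁅x⁆ t)) , t∈Nz₀ , t∉Nℓz₀
    size : ∣ Kept ∪ ⁅ t ⁆ ∣ ≤ n ∸ s G + 1
    size = ℕ.≤-trans (∣p∪q∣≤∣p∣+∣q∣ Kept ⁅ t ⁆)
                     (ℕ.+-mono-≤ ∣Kept∣≤n∸s (ℕ.≤-reflexive (∣⁅x⁆∣≡1 t)))
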